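{- Let $L$ be a set of simple structural rules and $A$ a BI algebra that validates every rule in $L$. If $\Delta\vdash\varphi$ is derivable in BI+$L$ (with cut), then $[\![\lceil\Delta\rceil]\!]\le[\![\varphi]\!]$ in $A$, for every interpretation of atoms in $A$.
   Context: Formulas of BI: $\varphi,\psi ::= \top \mid \bot \mid \varphi\wedge\psi \mid \varphi\vee\psi \mid \varphi\to\psi \mid \mathsf{emp} \mid \varphi * \psi \mid \varphi \mathrel{ -\!\!*} \psi \mid a$ ($a\in\mathrm{Atom}$). Bunches: $\Delta ::= \varphi \mid \varnothing_m \mid \varnothing_a \mid \Delta , \Delta \mid \Delta ; \Delta$. A bunched context $\Delta(-)$ is a bunch with one hole; $\Delta(\Gamma)$ fills it. Bunch equivalence $\equiv$: least equivalence relation, closed under bunched contexts, making "$,$" commutative and associative with unit $\varnothing_m$ and "$;$" commutative and associative with unit $\varnothing_a$. The BI sequent calculus: (ax) $a\vdash a$; (equiv) from $\Delta'\vdash\varphi$, $\Delta\equiv\Delta'$ infer $\Delta\vdash\varphi$; (W;) from $\Delta(\Delta_1)\vdash\varphi$ infer $\Delta(\Delta_1;\Delta_2)\vdash\varphi$; (C;) from $\Delta(\Delta_1;\Delta_1)\vdash\varphi$ infer $\Delta(\Delta_1)\vdash\varphi$; (cut) from $\Delta'\vdash A$ and $\Delta(A)\vdash B$ infer $\Delta(\Delta')\vdash B$; (empR) $\varnothing_m\vdash\mathsf{emp}$; (empL) from $\Delta(\varnothing_m)\vdash\varphi$ infer $\Delta(\mathsf{emp})\vdash\varphi$; (*R)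 from $\Delta_1\vdash\varphi$, $\Delta_2\vdash\psi$ infer $\Delta_1,\Delta_2\vdash\varphi*\psi$; (*L) from $\Delta(\varphi,\psi)\vdash\chi$ infer $\Delta(\varphi*\psi)\vdash\chi$; ($-\!*$R) from $\Delta,\varphi\vdash\psi$ infer $\Delta\vdash\varphi\mathrel{ -\!\!*}\psi$; ($-\!*$L) from $\Delta_1\vdash\varphi$, $\Delta(\Delta_2,\psi)\vdash\chi$ infer $\Delta((\Delta_1,\Delta_2),\varphi\mathrel{ -\!\!*}\psi)\vdash\chi$; ($\top$R) $\varnothing_a\vdash\top$; ($\top$L) from $\Delta(\varnothing_a)\vdash\varphi$ infer $\Delta(\top)\vdash\varphi$; ($\wedge$R) from $\Delta_1\vdash\varphi$, $\Delta_2\vdash\psi$ infer $\Delta_1;\Delta_2\vdash\varphi\wedge\psi$; ($\wedge$L) from $\Delta(\varphi;\psi)\vdash\chi$ infer $\Delta(\varphi\wedge\psi)\vdash\chi$; ($\to$R) from $\Delta;\varphi\vdash\psi$ infer $\Delta\vdash\varphi\to\psi$; ($\to$L) from $\Delta_1\vdash\varphi$, $\Delta(\Delta_2;\psi)\vdash\chi$ infer $\Delta((\Delta_1;\Delta_2);\varphi\to\psi)\vdash\chi$; ($\bot$L) $\Delta(\bot)\vdash\varphi$; ($\vee$R1/2) from $\Delta\vdash\varphi$ (resp. $\Delta\vdash\psi$) infer $\Delta\vdash\varphi\vee\psi$; ($\vee$L) from $\Delta(\varphi)\vdash\chi$, $\Delta(\psi)\vdash\chi$ infer $\Delta(\varphi\vee\psi)\vdash\chi$.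 A bunched term is a tree built from variables $x_1,\dots,x_n$ with binary nodes "$,$" and "$;$"; it is linear if each variable occurs at most once; $T[\vec\Delta]$ substitutes bunch $\Delta_j$ for $x_j$. A simple structural rule is a pair $(\{T_1,\dots,T_m\},T)$ with $T$ linear, denoting the rule: for every bunched context $\Pi$, bunches $\vec\Delta$ and formula $\varphi$, from $\Pi(T_i[\vec\Delta])\vdash\varphi$ for all $1\le i\le m$ infer $\Pi(T[\vec\Delta])\vdash\varphi$. BI+$L$ is the BI calculus plus the rules in $L$. A BI algebra is a bounded Heyting algebra $(B,\bot,\top,\wedge,\vee,\to)$ with a monotone commutative associative operation $*$ with unit $\mathsf{emp}$ and an operation $\mathrel{ -\!\!*}$ with $a*b\le c\iff a\le b\mathrel{ -\!\!*}c$. Formulas are interpreted homomorphically given an interpretation of atoms. $\lceil\Delta\rceil$ is the formula obtained from $\Delta$ by replacing "$,$" by $*$, "$;$" by $\wedge$, $\varnothing_m$ by $\mathsf{emp}$, $\varnothing_a$ by $\top$. A bunched term $T$ over $x_1,\dots,x_n$ induces a function $[\![T]\!]:A^n\to A$ by reading "$,$" as $*$ and "$;$" as $\wedge$. $A$ validates the rule $(\{T_1,\dots,T_m\},T)$ if $[\![T]\!](a_1,\dots,a_n)\le[\![T_1]\!](\vec a)\vee\dots\vee[\![T_m]\!](\vec a)$ for all $a_1,\dots,a_n\in A$. -}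

module Defs where

open import Level using (Level; _⊔_) renaming (suc to lsuc)
open import Data.Nat using (ℕ; zero; suc; _+_) renaming (_≤_ to _≤ℕ_)
open import Data.Fin using (Fin; zero; suc; _≟_)
open import Relation.Nullary using (yes; no)
open import Relation.Binary.Lattice.Bundles using (HeytingAlgebra)

infixr 6 _∧ᶠ_ _∨ᶠ_ _*ᶠ_
infixr 5 _→ᶠ_ _-*ᶠ_

data Formula (Atom : Set) : Set where
  ⊤ᶠ ⊥ᶠ    : Formula Atom
  _∧ᶠ_ _∨ᶠ_ _→ᶠ_ : Formula Atom → Formula Atom → Formula Atom
  empᶠ     : Formula Atom
  _*ᶠ_ _-*ᶠ_ : Formula Atom → Formula Atom → Formula Atom
  atom     : Atom → Formula Atom

infixl 4 _,ᵇ_ _⨾ᵇ_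

data Bunch (Atom : Set) : Set where
  fm   : Formula Atom → Bunch Atom
  ∅m   : Bunch Atom
  ∅a   : Bunch Atom
  _,ᵇ_ : Bunch Atom → Bunch Atom → Bunch Atom
  _⨾ᵇ_ : Bunch Atom → Bunch Atom → Bunch Atom

data Ctx (Atom : Set) : Set where
  hole  : Ctx Atom
  _,ˡ_  : Ctx Atom → Bunch Atom → Ctx Atom
  _,ʳ_  : Bunch Atom → Ctx Atom → Ctx Atom
  _⨾ˡ_  : Ctx Atom → Bunch Atom → Ctx Atom
  _⨾ʳ_  : Bunch Atom → Ctx Atom → Ctx Atom

_⟪_⟫ : ∀ {Atom} → Ctx Atom → Bunch Atom → Bunch Atom
hole     ⟪ Γ ⟫ = Γ
(Δ ,ˡ Θ) ⟪ Γ ⟫ = (Δ ⟪ Γ ⟫) ,ᵇ Θ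
(Θ ,ʳ Δ) ⟪ Γ ⟫ = Θ ,ᵇ (Δ ⟪ Γ ⟫)
(Δ ⨾ˡ Θ) ⟪ Γ ⟫ = (Δ ⟪ Γ ⟫) ⨾ᵇ Θ
(Θ ⨾ʳ Δ) ⟪ Γ ⟫ = Θ ⨾ᵇ (Δ ⟪ Γ ⟫)

infix 3 _≡ᵇ_
data _≡ᵇ_ {Atom : Set} : Bunch Atom → Bunch Atom → Set where
  ≡-refl  : ∀ {Δ} → Δ ≡ᵇ Δ
  ≡-sym   : ∀ {Δ Δ'} → Δ ≡ᵇ Δ' → Δ' ≡ᵇ Δ
  ≡-trans : ∀ {Δ Δ' Δ''} → Δ ≡ᵇ Δ' → Δ' ≡ᵇ Δ'' → Δ ≡ᵇ Δ''
  ≡-ctx   : ∀ (Π : Ctx Atom) {Γ Γ'} → Γ ≡ᵇ Γ' → Π ⟪ Γ ⟫ ≡ᵇ Π ⟪ Γ' ⟫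
  ,-comm  : ∀ {Γ₁ Γ₂} → (Γ₁ ,ᵇ Γ₂) ≡ᵇ (Γ₂ ,ᵇ Γ₁)
  ,-assoc : ∀ {Γ₁ Γ₂ Γ₃} → ((Γ₁ ,ᵇ Γ₂) ,ᵇ Γ₃) ≡ᵇ (Γ₁ ,ᵇ (Γ₂ ,ᵇ Γ₃))
  ,-unit  : ∀ {Γ} → (Γ ,ᵇ ∅m) ≡ᵇ Γ
  ⨾-comm  : ∀ {Γ₁ Γ₂} → (Γ₁ ⨾ᵇ Γ₂) ≡ᵇ (Γ₂ ⨾ᵇ Γ₁)
  ⨾-assoc : ∀ {Γ₁ Γ₂ Γ₃} → ((Γ₁ ⨾ᵇ Γ₂) ⨾ᵇ Γ₃) ≡ᵇ (Γ₁ ⨾ᵇ (Γ₂ ⨾ᵇ Γ₃))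
  ⨾-unit  : ∀ {Γ} → (Γ ⨾ᵇ ∅a) ≡ᵇ Γ

data Term (n : ℕ) : Set where
  var   : Fin n → Term n
  _,ᵗ_  : Term n → Term n → Term n
  _⨾ᵗ_  : Term n → Term n → Term n

occ : ∀ {n} → Fin n → Term n → ℕ
occ i (var j) with i ≟ j
... | yes _ = 1
... | no  _ = 0
occ i (T ,ᵗ U) = occ i T + occ i U
occ i (T ⨾ᵗ U) = occ i T + occ i U

Linear : ∀ {n} → Term n → Set
Linear {n} T = (i : Fin n) → occ i T ≤ℕ 1

_[_]ᵗ : ∀ {n Atom} → Term n → (Fin n → Bunch Atom) → Bunch Atom
var j    [ Δs ]ᵗ = Δs j
(T ,ᵗ U) [ Δs ]ᵗ = (T [ Δs ]ᵗ) ,ᵇ (U [ Δs ]ᵗ)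
(T ⨾ᵗ U) [ Δs ]ᵗ = (T [ Δs ]ᵗ) ⨾ᵇ (U [ Δs ]ᵗ)

record SimpleRule : Set where
  field
    nvars      : ℕ
    npremises  : ℕ
    premise    : Fin npremises → Term nvars
    conclusion : Term nvars
    linear     : Linear conclusion
open SimpleRule public

infix 2 _⊢[_]_
data _⊢[_]_ {Atom : Set} : Bunch Atom → (SimpleRule → Set) → Formula Atom → Set₁ where
  ax    : ∀ {L a} → fm (atom a) ⊢[ L ] atom a
  equiv : ∀ {L Δ Δ' φ} → Δ' ⊢[ L ] φ → Δ ≡ᵇ Δ' → Δ ⊢[ L ] φ
  W⨾    : ∀ {L} (Δ : Ctx Atom) {Δ₁ Δ₂ φ} → Δ ⟪ Δ₁ ⟫ ⊢[ L ] φ → Δ ⟪ Δ₁ ⨾ᵇ Δ₂ ⟫ ⊢[ L ] φ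
  C⨾    : ∀ {L} (Δ : Ctx Atom) {Δ₁ φ} → Δ ⟪ Δ₁ ⨾ᵇ Δ₁ ⟫ ⊢[ L ] φ → Δ ⟪ Δ₁ ⟫ ⊢[ L ] φ
  cut   : ∀ {L} (Δ : Ctx Atom) {Δ' A B} → Δ' ⊢[ L ] A → Δ ⟪ fm A ⟫ ⊢[ L ] B → Δ ⟪ Δ' ⟫ ⊢[ L ] B
  empR  : ∀ {L} → ∅m ⊢[ L ] empᶠ
  empL  : ∀ {L} (Δ : Ctx Atom) {φ} → Δ ⟪ ∅m ⟫ ⊢[ L ] φ → Δ ⟪ fm empᶠ ⟫ ⊢[ L ] φ
  *R    : ∀ {L Δ₁ Δ₂ φ ψ} → Δ₁ ⊢[ L ] φ → Δ₂ ⊢[ L ] ψ → (Δ₁ ,ᵇ Δ₂) ⊢[ L ] φ *ᶠ ψ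
  *L    : ∀ {L} (Δ : Ctx Atom) {φ ψ χ} → Δ ⟪ fm φ ,ᵇ fm ψ ⟫ ⊢[ L ] χ → Δ ⟪ fm (φ *ᶠ ψ) ⟫ ⊢[ L ] χ
  -*R   : ∀ {L Δ φ ψ} → (Δ ,ᵇ fm φ) ⊢[ L ] ψ → Δ ⊢[ L ] φ -*ᶠ ψ
  -*L   : ∀ {L} (Δ : Ctx Atom) {Δ₁ Δ₂ φ ψ χ} → Δ₁ ⊢[ L ] φ → Δ ⟪ Δ₂ ,ᵇ fm ψ ⟫ ⊢[ L ] χ
          → Δ ⟪ (Δ₁ ,ᵇ Δ₂) ,ᵇ fm (φ -*ᶠ ψ) ⟫ ⊢[ L ] χ
  ⊤R    : ∀ {L} → ∅a ⊢[ L ] ⊤ᶠ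
  ⊤L    : ∀ {L} (Δ : Ctx Atom) {φ} → Δ ⟪ ∅a ⟫ ⊢[ L ] φ → Δ ⟪ fm ⊤ᶠ ⟫ ⊢[ L ] φ
  ∧R    : ∀ {L Δ₁ Δ₂ φ ψ} → Δ₁ ⊢[ L ] φ → Δ₂ ⊢[ L ] ψ → (Δ₁ ⨾ᵇ Δ₂) ⊢[ L ] φ ∧ᶠ ψ
  ∧L    : ∀ {L} (Δ : Ctx Atom) {φ ψ χ} → Δ ⟪ fm φ ⨾ᵇ fm ψ ⟫ ⊢[ L ] χ → Δ ⟪ fm (φ ∧ᶠ ψ) ⟫ ⊢[ L ] χ
  →R    : ∀ {L Δ φ ψ} → (Δ ⨾ᵇ fm φ) ⊢[ L ] ψ → Δ ⊢[ L ] φ →ᶠ ψ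
  →L    : ∀ {L} (Δ : Ctx Atom) {Δ₁ Δ₂ φ ψ χ} → Δ₁ ⊢[ L ] φ → Δ ⟪ Δ₂ ⨾ᵇ fm ψ ⟫ ⊢[ L ] χ
          → Δ ⟪ (Δ₁ ⨾ᵇ Δ₂) ⨾ᵇ fm (φ →ᶠ ψ) ⟫ ⊢[ L ] χ
  ⊥L    : ∀ {L} (Δ : Ctx Atom) {φ} → Δ ⟪ fm ⊥ᶠ ⟫ ⊢[ L ] φ
  ∨R₁   : ∀ {L Δ φ ψ} → Δ ⊢[ L ] φ → Δ ⊢[ L ] φ ∨ᶠ ψ
  ∨R₂   : ∀ {L Δ φ ψ} → Δ ⊢[ L ] ψ → Δ ⊢[ L ] φ ∨ᶠ ψ
  ∨L    : ∀ {L} (Δ : Ctx Atom) {φ ψ χ} → Δ ⟪ fm φ ⟫ ⊢[ L ] χ → Δ ⟪ fm ψ ⟫ ⊢[ L ] χ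
          → Δ ⟪ fm (φ ∨ᶠ ψ) ⟫ ⊢[ L ] χ
  struct : ∀ {L} (r : SimpleRule) → L r → (Π : Ctx Atom) (Δs : Fin (nvars r) → Bunch Atom) → ∀ {φ}
           → ((i : Fin (npremises r)) → Π ⟪ premise r i [ Δs ]ᵗ ⟫ ⊢[ L ] φ)
           → Π ⟪ conclusion r [ Δs ]ᵗ ⟫ ⊢[ L ] φ

⌈_⌉ : ∀ {Atom} → Bunch Atom → Formula Atom
⌈ fm φ ⌉     = φ
⌈ ∅m ⌉       = empᶠ
⌈ ∅a ⌉       = ⊤ᶠ
⌈ Δ ,ᵇ Γ ⌉   = ⌈ Δ ⌉ *ᶠ ⌈ Γ ⌉
⌈ Δ ⨾ᵇ Γ ⌉   = ⌈ Δ ⌉ ∧ᶠ ⌈ Γ ⌉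

record BIAlgebra c ℓ₁ ℓ₂ : Set (lsuc (c ⊔ ℓ₁ ⊔ ℓ₂)) where
  field
    heyting : HeytingAlgebra c ℓ₁ ℓ₂
  open HeytingAlgebra heyting public
  infixr 7 _*_
  infixr 5 _-*_
  field
    _*_     : Carrier → Carrier → Carrier
    emp     : Carrier
    _-*_    : Carrier → Carrier → Carrier
    *-mono  : ∀ {a b c d} → a ≤ b → c ≤ d → (a * c) ≤ (b * d)
    *-comm  : ∀ a b → (a * b) ≈ (b * a)
    *-assoc : ∀ a b c → ((a * b) * c) ≈ (a * (b * c))
    *-unit  : ∀ a → (a * emp) ≈ a
    resid⇒  : ∀ {a b c} → (a * b) ≤ c → a ≤ (b -* c)
    resid⇐  : ∀ {a b c} → a ≤ (b -* c) → (a * b) ≤ c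

module _ {c ℓ₁ ℓ₂} (A : BIAlgebra c ℓ₁ ℓ₂) where
  open BIAlgebra A

  ⟦_⟧ : ∀ {Atom} → Formula Atom → (Atom → Carrier) → Carrier
  ⟦ ⊤ᶠ ⟧ ρ      = ⊤
  ⟦ ⊥ᶠ ⟧ ρ      = ⊥
  ⟦ φ ∧ᶠ ψ ⟧ ρ  = ⟦ φ ⟧ ρ ∧ ⟦ ψ ⟧ ρ
  ⟦ φ ∨ᶠ ψ ⟧ ρ  = ⟦ φ ⟧ ρ ∨ ⟦ ψ ⟧ ρ
  ⟦ φ →ᶠ ψ ⟧ ρ  = ⟦ φ ⟧ ρ ⇨ ⟦ ψ ⟧ ρ
  ⟦ empᶠ ⟧ ρ    = emp
  ⟦ φ *ᶠ ψ ⟧ ρ  = ⟦ φ ⟧ ρ * ⟦ ψ ⟧ ρ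
  ⟦ φ -*ᶠ ψ ⟧ ρ = ⟦ φ ⟧ ρ -* ⟦ ψ ⟧ ρ
  ⟦ atom a ⟧ ρ  = ρ a

  ⟦_⟧ᵗ : ∀ {n} → Term n → (Fin n → Carrier) → Carrier
  ⟦ var j ⟧ᵗ as    = as j
  ⟦ T ,ᵗ U ⟧ᵗ as   = ⟦ T ⟧ᵗ as * ⟦ U ⟧ᵗ as
  ⟦ T ⨾ᵗ U ⟧ᵗ as   = ⟦ T ⟧ᵗ as ∧ ⟦ U ⟧ᵗ as

  ⋁ : ∀ {m} → (Fin m → Carrier) → Carrier
  ⋁ {zero}  xs = ⊥
  ⋁ {suc m} xs = xs zero ∨ ⋁ (λ i → xs (suc i))

  Validates : SimpleRule → Set (c ⊔ ℓ₂)
  Validates r = (as : Fin (nvars r) → Carrier)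
              → ⟦ conclusion r ⟧ᵗ as ≤ ⋁ (λ i → ⟦ premise r i ⟧ᵗ as)

-- The denotation Γ ↦ ⟦Π⟪Γ⟫⟧ of a bunched context Π is a lower adjoint: its
-- upper adjoint Π ⊸ v is built from -* and ⇨ along the path to the hole. So a
-- sequent Π⟪Γ⟫ ⊢ φ is valid iff ⟦Γ⟧ ≤ Π ⊸ ⟦φ⟧. Every left rule acting deep inside
-- a context then reduces to an inequality at the hole, and since lower adjoints
-- preserve finite joins, the disjunctive conclusion of a validated structural rule
-- is harmless inside a context, as are ∨L and ⊥L.
module Submission where

open import Defs
open import Data.Nat using (zero; suc)
open import Data.Fin using (Fin; zero; suc)
open import Function.Base using (_∘_)
open import Relation.Binary.PropositionalEquality as ≡ using (_≡_; cong₂; subst)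

module Soundness {c ℓ₁ ℓ₂} (A : BIAlgebra c ℓ₁ ℓ₂) where
  open BIAlgebra A
  open import Relation.Binary.Lattice.Properties.HeytingAlgebra heyting using (⇨-applyʳ)
  open import Relation.Binary.Lattice.Properties.MeetSemilattice meetSemilattice
    using (∧-comm; ∧-assoc; ∧-monotonic)
  open import Relation.Binary.Lattice.Properties.BoundedMeetSemilattice boundedMeetSemilattice
    using (identityʳ)
  open import Relation.Binary.Reasoning.PartialOrder poset

  ⋁-least : ∀ {m} (xs : Fin m → Carrier) {y} → (∀ i → xs i ≤ y) → ⋁ A xs ≤ y
  ⋁-least {zero}  xs h = minimum _
  ⋁-least {suc m} xs h = ∨-least (h zero) (⋁-least (xs ∘ suc) (h ∘ suc))

  -*-applyʳ : ∀ {a b d} → a ≤ b → a * (b -* d) ≤ d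
  -*-applyʳ {a} {b} {d} a≤b = begin
    a * (b -* d)   ≈⟨ *-comm a (b -* d) ⟩
    (b -* d) * a   ≤⟨ *-mono refl a≤b ⟩
    (b -* d) * b   ≤⟨ resid⇐ refl ⟩
    d              ∎

  -*-modus-ponens : ∀ {a b c d} → a ≤ b → (a * c) * (b -* d) ≤ c * d
  -*-modus-ponens {a} {b} {c} {d} a≤b = begin
    (a * c) * (b -* d)   ≤⟨ *-mono (reflexive (*-comm a c)) refl ⟩
    (c * a) * (b -* d)   ≈⟨ *-assoc c a (b -* d) ⟩
    c * (a * (b -* d))   ≤⟨ *-mono refl (-*-applyʳ a≤b) ⟩
    c * d                ∎

  ⇨-modus-ponens : ∀ {a b c d} → a ≤ b → (a ∧ c) ∧ (b ⇨ d) ≤ c ∧ d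
  ⇨-modus-ponens a≤b = ∧-greatest (trans (x∧y≤x _ _) (x∧y≤y _ _))
                                  (⇨-applyʳ (trans (x∧y≤x _ _) a≤b))

  module _ {Atom : Set} (ρ : Atom → Carrier) where

    ⟦_⟧ᶠ : Formula Atom → Carrier
    ⟦ φ ⟧ᶠ = ⟦_⟧ A φ ρ

    ⟦_⟧ᵇ : Bunch Atom → Carrier
    ⟦ Δ ⟧ᵇ = ⟦ ⌈ Δ ⌉ ⟧ᶠ

    infix 2 _⊨_
    _⊨_ : Bunch Atom → Formula Atom → Set ℓ₂
    Δ ⊨ φ = ⟦ Δ ⟧ᵇ ≤ ⟦ φ ⟧ᶠ

    infixr 5 _⊸_
    _⊸_ : Ctx Atom → Carrier → Carrier
    hole     ⊸ v = v
    (Π ,ˡ Θ) ⊸ v = Π ⊸ (⟦ Θ ⟧ᵇ -* v)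
    (Θ ,ʳ Π) ⊸ v = Π ⊸ (⟦ Θ ⟧ᵇ -* v)
    (Π ⨾ˡ Θ) ⊸ v = Π ⊸ (⟦ Θ ⟧ᵇ ⇨ v)
    (Θ ⨾ʳ Π) ⊸ v = Π ⊸ (⟦ Θ ⟧ᵇ ⇨ v)

    plug⇒⊸ : ∀ Π {Γ v} → ⟦ Π ⟪ Γ ⟫ ⟧ᵇ ≤ v → ⟦ Γ ⟧ᵇ ≤ Π ⊸ v
    plug⇒⊸ hole     h = h
    plug⇒⊸ (Π ,ˡ Θ) h = plug⇒⊸ Π (resid⇒ h)
    plug⇒⊸ (Θ ,ʳ Π) h = plug⇒⊸ Π (resid⇒ (trans (reflexive (*-comm _ _)) h))
    plug⇒⊸ (Π ⨾ˡ Θ) h = plug⇒⊸ Π (transpose-⇨ h)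
    plug⇒⊸ (Θ ⨾ʳ Π) h = plug⇒⊸ Π (transpose-⇨ (trans (reflexive (∧-comm _ _)) h))

    ⊸⇒plug : ∀ Π {Γ v} → ⟦ Γ ⟧ᵇ ≤ Π ⊸ v → ⟦ Π ⟪ Γ ⟫ ⟧ᵇ ≤ v
    ⊸⇒plug hole     h = h
    ⊸⇒plug (Π ,ˡ Θ) h = resid⇐ (⊸⇒plug Π h)
    ⊸⇒plug (Θ ,ʳ Π) h = trans (reflexive (*-comm _ _)) (resid⇐ (⊸⇒plug Π h))
    ⊸⇒plug (Π ⨾ˡ Θ) h = transpose-∧ (⊸⇒plug Π h)
    ⊸⇒plug (Θ ⨾ʳ Π) h = trans (reflexive (∧-comm _ _)) (transpose-∧ (⊸⇒plug Π h))

    plug-≤ : ∀ Π {X Y v} → ⟦ Y ⟧ᵇ ≤ ⟦ X ⟧ᵇ → ⟦ Π ⟪ X ⟫ ⟧ᵇ ≤ v → ⟦ Π ⟪ Y ⟫ ⟧ᵇ ≤ v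
    plug-≤ Π Y≤X h = ⊸⇒plug Π (trans Y≤X (plug⇒⊸ Π h))

    plug-cong : ∀ Π {Γ Γ'} → ⟦ Γ ⟧ᵇ ≈ ⟦ Γ' ⟧ᵇ → ⟦ Π ⟪ Γ ⟫ ⟧ᵇ ≈ ⟦ Π ⟪ Γ' ⟫ ⟧ᵇ
    plug-cong Π Γ≈Γ' = antisym (plug-≤ Π (reflexive Γ≈Γ') refl)
                               (plug-≤ Π (reflexive (Eq.sym Γ≈Γ')) refl)

    ≡ᵇ-sound : ∀ {Δ Δ'} → Δ ≡ᵇ Δ' → ⟦ Δ ⟧ᵇ ≈ ⟦ Δ' ⟧ᵇ
    ≡ᵇ-sound ≡-refl        = Eq.refl
    ≡ᵇ-sound (≡-sym e)     = Eq.sym (≡ᵇ-sound e)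
    ≡ᵇ-sound (≡-trans e f) = Eq.trans (≡ᵇ-sound e) (≡ᵇ-sound f)
    ≡ᵇ-sound (≡-ctx Π e)   = plug-cong Π (≡ᵇ-sound e)
    ≡ᵇ-sound ,-comm        = *-comm _ _
    ≡ᵇ-sound ,-assoc       = *-assoc _ _ _
    ≡ᵇ-sound ,-unit        = *-unit _
    ≡ᵇ-sound ⨾-comm        = ∧-comm _ _
    ≡ᵇ-sound ⨾-assoc       = ∧-assoc _ _ _
    ≡ᵇ-sound ⨾-unit        = identityʳ _

    ⟦[]ᵗ⟧ : ∀ {n} (T : Term n) (Δs : Fin n → Bunch Atom) → ⟦ T [ Δs ]ᵗ ⟧ᵇ ≡ ⟦_⟧ᵗ A T (⟦_⟧ᵇ ∘ Δs)
    ⟦[]ᵗ⟧ (var j)  Δs = ≡.refl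
    ⟦[]ᵗ⟧ (T ,ᵗ U) Δs = cong₂ _*_ (⟦[]ᵗ⟧ T Δs) (⟦[]ᵗ⟧ U Δs)
    ⟦[]ᵗ⟧ (T ⨾ᵗ U) Δs = cong₂ _∧_ (⟦[]ᵗ⟧ T Δs) (⟦[]ᵗ⟧ U Δs)

    validated-rule-sound : ∀ r (Π : Ctx Atom) (Δs : Fin (nvars r) → Bunch Atom) {φ}
      → Validates A r
      → (∀ i → Π ⟪ premise r i [ Δs ]ᵗ ⟫ ⊨ φ)
      → Π ⟪ conclusion r [ Δs ]ᵗ ⟫ ⊨ φ
    validated-rule-sound r Π Δs {φ} valid premises =
      ⊸⇒plug Π (below (≡.sym (⟦[]ᵗ⟧ (conclusion r) Δs))
        (trans (valid (⟦_⟧ᵇ ∘ Δs))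
          (⋁-least _ λ i → below (⟦[]ᵗ⟧ (premise r i) Δs) (plug⇒⊸ Π (premises i)))))
      where
      below : ∀ {x y} → x ≡ y → x ≤ Π ⊸ ⟦ φ ⟧ᶠ → y ≤ Π ⊸ ⟦ φ ⟧ᶠ
      below = subst (_≤ Π ⊸ ⟦ φ ⟧ᶠ)

    sound : ∀ {L} → (∀ r → L r → Validates A r) → ∀ {Δ φ} → Δ ⊢[ L ] φ → Δ ⊨ φ
    sound V ax               = refl
    sound V (equiv d e)      = trans (reflexive (≡ᵇ-sound e)) (sound V d)
    sound V (W⨾ Π d)         = plug-≤ Π (x∧y≤x _ _) (sound V d)
    sound V (C⨾ Π d)         = plug-≤ Π (∧-greatest refl refl) (sound V d)
    sound V (cut Π d e)      = plug-≤ Π (sound V d) (sound V e)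
    sound V empR             = refl
    sound V (empL Π d)       = plug-≤ Π refl (sound V d)
    sound V (*R d e)         = *-mono (sound V d) (sound V e)
    sound V (*L Π d)         = plug-≤ Π refl (sound V d)
    sound V (-*R d)          = resid⇒ (sound V d)
    sound V (-*L Π d e)      = plug-≤ Π (-*-modus-ponens (sound V d)) (sound V e)
    sound V ⊤R               = refl
    sound V (⊤L Π d)         = plug-≤ Π refl (sound V d)
    sound V (∧R d e)         = ∧-monotonic (sound V d) (sound V e)
    sound V (∧L Π d)         = plug-≤ Π refl (sound V d)
    sound V (→R d)           = transpose-⇨ (sound V d)
    sound V (→L Π d e)       = plug-≤ Π (⇨-modus-ponens (sound V d)) (sound V e)
    sound V (⊥L Π)           = ⊸⇒plug Π (minimum _)
    sound V (∨R₁ d)          = trans (sound V d) (x≤x∨y _ _)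
    sound V (∨R₂ d)          = trans (sound V d) (y≤x∨y _ _)
    sound V (∨L Π d e)       = ⊸⇒plug Π (∨-least (plug⇒⊸ Π (sound V d)) (plug⇒⊸ Π (sound V e)))
    sound V (struct r r∈L Π Δs {φ} ds) =
      validated-rule-sound r Π Δs {φ} (V r r∈L) (sound V ∘ ds)

lemma7p1 : ∀ {c ℓ₁ ℓ₂} {Atom : Set} (L : SimpleRule → Set) (A : BIAlgebra c ℓ₁ ℓ₂)
    → (∀ r → L r → Validates A r)
    → ∀ {Δ : Bunch Atom} {φ : Formula Atom} → Δ ⊢[ L ] φ
    → (ρ : Atom → BIAlgebra.Carrier A)
    → BIAlgebra._≤_ A (⟦_⟧ A ⌈ Δ ⌉ ρ) (⟦_⟧ A φ ρ)
lemma7p1 L A V d ρ = Soundness.sound A ρ V d
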